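{- Let $a,b$ be two distinct letters of the finite alphabet $\Sigma$. There exists a sentence $\varphi$ of the $\mu$-fragment such that for every finite data word $w$: $w\models\varphi$ iff the relation $R=\{(x,y)\mid a_x=a,\ a_y=b,\ x\sim y\}$ is a bijection from the set of $a$-labelled positions of $w$ onto the set of $b$-labelled positions of $w$ which is increasing (i.e. $x<x'$ implies $R(x)<R(x')$).
   Context: Data words: finite sequences $w=(a_1,d_1)\cdots(a_n,d_n)$ over $\Sigma\times\mathcal D$ ($\mathcal D$ infinite), positions $1,\dots,n$; $x\sim y$ iff $d_x=d_y$; class successor/predecessor of $i$: least $j>i$ / greatest $j<i$ with $j\sim i$, if any. $\mu$-calculus: $\varphi::= x\mid A\mid\neg A\mid \mathsf M\varphi\mid\varphi\vee\varphi\mid\varphi\wedge\varphi\mid\mu x.\varphi\mid\nu x.\varphi$, atoms $A$: letters of $\Sigma$ (holding where they label the position) and $\mathsf S,\mathsf P,\mathsf{first}^g,\mathsf{last}^g,\mathsf{first}^c,\mathsf{last}^c$ ($\mathsf{first}^g$/$\mathsf{last}^g$ at first/last position; $\mathsf{first}^c$/$\mathsf{last}^c$ where there is no class predecessor/successor; $\mathsf S$ at $i$ iff $i$ not last and $i+1$ is the class successor of $i$; $\mathsf P$ at $i$ iff $i\ne1$ and $i-1$ is the class predecessor of $i$); $\mathsf M\in\{\mathtt X^g,\mathtt X^c,\mathtt Y^g,\mathtt Y^c\}$ evaluating the argument at successor, class successor, predecessor, class predecessor (false if nonexistent); $\mu,\nu$ least/greatest fixpoints. $w\models\varphi$ iff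 $\varphi$ holds at position 1. The $\mu$-fragment: formulas in which $\nu$ does not occur. -}

module Defs where

open import Data.Nat using (ℕ; zero; suc)
open import Data.Fin using (Fin; toℕ) renaming (_<_ to _<ᶠ_)
open import Data.Bool using (Bool; T)
open import Data.Product using (Σ; _×_; _,_)
open import Data.Empty using (⊥)
open import Relation.Nullary using (¬_)
open import Relation.Binary.PropositionalEquality using (_≡_; _≢_)
open import Data.Vec.Functional using (Vector; _∷_; [])

-- Data words over the alphabet Σ = Fin s with data domain 𝒟 = ℕ.
-- A data word of length n has positions Fin n (0-based: position i
-- of Agda is position i+1 of the paper).

record DataWord (s n : ℕ) : Set where
  constructor mkWord
  field
    lab : Fin n → Fin s
    dat : Fin n → ℕ

open DataWord public

module _ {s n : ℕ} (w : DataWord s n) where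

  _∼_ : Fin n → Fin n → Set
  x ∼ y = dat w x ≡ dat w y

  ClassSucc : Fin n → Fin n → Set
  ClassSucc i j = (i <ᶠ j) × (j ∼ i) × (∀ l → i <ᶠ l → l <ᶠ j → ¬ (l ∼ i))

  ClassPred : Fin n → Fin n → Set
  ClassPred i j = (j <ᶠ i) × (j ∼ i) × (∀ l → j <ᶠ l → l <ᶠ i → ¬ (l ∼ i))

  GSucc : Fin n → Fin n → Set
  GSucc i j = toℕ j ≡ suc (toℕ i)

data Atom (s : ℕ) : Set where
  letter  : Fin s → Atom s
  S P     : Atom s
  firstᵍ lastᵍ firstᶜ lastᶜ : Atom s

data Mod : Set where
  Xᵍ Xᶜ Yᵍ Yᶜ : Mod

data Form (s : ℕ) : ℕ → Set where
  var  : ∀ {m} → Fin m → Form s m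
  pos  : ∀ {m} → Atom s → Form s m
  neg  : ∀ {m} → Atom s → Form s m
  mod  : ∀ {m} → Mod → Form s m → Form s m
  _∨ᶠ_ : ∀ {m} → Form s m → Form s m → Form s m
  _∧ᶠ_ : ∀ {m} → Form s m → Form s m → Form s m
  μ    : ∀ {m} → Form s (suc m) → Form s m   -- μ x. φ, x bound = index 0
  ν    : ∀ {m} → Form s (suc m) → Form s m

Sentence : ℕ → Set
Sentence s = Form s 0

NuFree : ∀ {s m} → Form s m → Set
NuFree (var x)   = Data.Unit.⊤ where import Data.Unit
NuFree (pos A)   = Data.Unit.⊤ where import Data.Unit
NuFree (neg A)   = Data.Unit.⊤ where import Data.Unit
NuFree (mod M φ) = NuFree φ
NuFree (φ ∨ᶠ ψ)  = NuFree φ × NuFree ψ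
NuFree (φ ∧ᶠ ψ)  = NuFree φ × NuFree ψ
NuFree (μ φ)     = NuFree φ
NuFree (ν φ)     = ⊥

module _ {s n : ℕ} (w : DataWord s n) where

  AtomHolds : Atom s → Fin n → Set
  AtomHolds (letter a) i = lab w i ≡ a
  AtomHolds S i = Σ (Fin n) λ j → GSucc w i j × ClassSucc w i j
  AtomHolds P i = Σ (Fin n) λ j → GSucc w j i × ClassPred w i j
  AtomHolds firstᵍ i = toℕ i ≡ 0
  AtomHolds lastᵍ i = suc (toℕ i) ≡ n
  AtomHolds firstᶜ i = ¬ (Σ (Fin n) λ j → ClassPred w i j)
  AtomHolds lastᶜ i = ¬ (Σ (Fin n) λ j → ClassSucc w i j)

  ModRel : Mod → Fin n → Fin n → Set
  ModRel Xᵍ i j = GSucc w i j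
  ModRel Xᶜ i j = ClassSucc w i j
  ModRel Yᵍ i j = GSucc w j i
  ModRel Yᶜ i j = ClassPred w i j

  -- Subsets of positions are Fin n → Bool; a valuation assigns one to
  -- each free variable.  Fixpoints via Knaster–Tarski:
  --   μ x.φ = ⋂ { S | ⟦φ⟧[x↦S] ⊆ S },   ν x.φ = ⋃ { S | S ⊆ ⟦φ⟧[x↦S] }.
  Sat : ∀ {m} → Vector (Fin n → Bool) m → Form s m → Fin n → Set
  Sat ρ (var x) i   = T (ρ x i)
  Sat ρ (pos A) i   = AtomHolds A i
  Sat ρ (neg A) i   = ¬ AtomHolds A i
  Sat ρ (mod M φ) i = Σ (Fin n) λ j → ModRel M i j × Sat ρ φ j
  Sat ρ (φ ∨ᶠ ψ) i  = Sat ρ φ i Data.Sum.⊎ Sat ρ ψ i where import Data.Sum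
  Sat ρ (φ ∧ᶠ ψ) i  = Sat ρ φ i × Sat ρ ψ i
  Sat ρ (μ φ) i     = (X : Fin n → Bool) →
                      (∀ j → Sat (X ∷ ρ) φ j → T (X j)) → T (X i)
  Sat ρ (ν φ) i     = Σ (Fin n → Bool) λ X →
                      (∀ j → T (X j) → Sat (X ∷ ρ) φ j) × T (X i)

-- w ⊨ φ : φ holds at the first position (words are nonempty: length suc m)
_⊨_ : ∀ {s m} → DataWord s (suc m) → Sentence s → Set
w ⊨ φ = Sat w [] φ Fin.zero where import Data.Fin as Fin

module _ {s n : ℕ} (a b : Fin s) (w : DataWord s n) where

  R : Fin n → Fin n → Set
  R x y = (lab w x ≡ a) × (lab w y ≡ b) × (dat w x ≡ dat w y)

  IncreasingBijection : Set
  IncreasingBijection =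
    (∀ x → lab w x ≡ a → Σ (Fin n) λ y → R x y × (∀ y' → R x y' → y' ≡ y)) ×
    (∀ y → lab w y ≡ b → Σ (Fin n) λ x → R x y × (∀ x' → R x' y → x' ≡ x)) ×
    (∀ x x' y y' → R x y → R x' y' → x <ᶠ x' → y <ᶠ y')

module Submission where

-- The sentence is  Φ = local ∧ □ Xᵍ local,  "local holds
-- everywhere", where local = matched a b ∧ matched b a ∧ ordered:
--   * matched c d : "a c-position has a d-position in its class, and no later
--     c-position in its class";  both together say that the relation R is a
--     bijection between a- and b-positions;
--   * ordered = μX. □ Yᵍ X ∧ (¬a ∨ E(b ∧ □ Yᵍ (¬b ∨ E(a ∧ X)))), with E θ
--     "θ elsewhere in the class": its least fixpoint holds at x iff, for
--     every z ≤ x, each b preceding the partner of z has its own partner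
--     before z; holding everywhere, this is the monotonicity of R.

open import Defs
open import Data.Nat using (ℕ; zero; suc; z<s)
import Data.Nat as ℕ
import Data.Nat.Properties as ℕP
open import Data.Fin using (Fin; zero; suc; toℕ; fromℕ<; inject₁; lift)
  renaming (_<_ to _<ᶠ_; _≤_ to _≤ᶠ_)
import Data.Fin.Properties as FP
open import Data.Fin.Induction using (<-wellFounded; >-wellFounded)
open import Data.Fin.Subset.Properties using (anySubset?)
open import Data.Vec using (lookup; tabulate)
open import Data.Vec.Properties using (lookup∘tabulate)
open import Data.Vec.Functional using (Vector; _∷_; [])
open import Induction.WellFounded using (WellFounded; Acc; acc; module Subrelation)
open import Data.Bool using (Bool; T; T?)
open import Data.Unit using (⊤; tt)
open import Data.Product using (Σ; ∃; _×_; _,_; proj₁; proj₂)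
import Data.Product as Product
open import Data.Sum using (_⊎_; inj₁; inj₂)
import Data.Sum as Sum
open import Data.Empty using (⊥-elim)
open import Function using (id; flip)
open import Function.Bundles using (_⇔_; mk⇔; Equivalence)
open import Function.Properties.Equivalence using () renaming (trans to ⇔-trans)
open import Relation.Nullary using (¬_; Dec; yes; no)
open import Relation.Nullary.Decidable
  using (_×-dec_; _⊎-dec_; _→-dec_; ¬?; map′; decidable-stable; isYes; toWitness; fromWitness)
open import Relation.Binary.PropositionalEquality using (_≡_; _≢_; _≗_; refl; sym; trans; cong; subst)
open import Relation.Binary.Definitions using (tri<; tri≈; tri>)

open Equivalence using (to; from)

ren : ∀ {s m k} → (Fin m → Fin k) → Form s m → Form s k
ren r (var x)   = var (r x)
ren r (pos A)   = pos A
ren r (neg A)   = neg A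
ren r (mod M φ) = mod M (ren r φ)
ren r (φ ∨ᶠ ψ)  = ren r φ ∨ᶠ ren r ψ
ren r (φ ∧ᶠ ψ)  = ren r φ ∧ᶠ ren r ψ
ren r (μ φ)     = μ (ren (lift 1 r) φ)
ren r (ν φ)     = ν (ren (lift 1 r) φ)

wk : ∀ {s m} → Form s m → Form s (suc m)
wk = ren suc

-- Membership in the μ-fragment is decidable, so it is certified by evaluation.
nuFree? : ∀ {s m} (φ : Form s m) → Dec (NuFree φ)
nuFree? (var x)   = yes tt
nuFree? (pos A)   = yes tt
nuFree? (neg A)   = yes tt
nuFree? (mod M φ) = nuFree? φ
nuFree? (φ ∨ᶠ ψ)  = nuFree? φ ×-dec nuFree? ψ
nuFree? (φ ∧ᶠ ψ)  = nuFree? φ ×-dec nuFree? ψ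
nuFree? (μ φ)     = nuFree? φ
nuFree? (ν φ)     = no λ ()

edge : ∀ {s} → Mod → Atom s
edge Xᵍ = lastᵍ
edge Xᶜ = lastᶜ
edge Yᵍ = firstᵍ
edge Yᶜ = firstᶜ

◇ : ∀ {s m} → Mod → Form s m → Form s m
◇ M θ = μ (mod M (wk θ ∨ᶠ var zero))

□ : ∀ {s m} → Mod → Form s m → Form s m
□ M θ = μ (pos (edge M) ∨ᶠ mod M (wk θ ∧ᶠ var zero))

elsewhere : ∀ {s m} → Form s m → Form s m
elsewhere θ = ◇ Xᶜ θ ∨ᶠ ◇ Yᶜ θ

Invariant : ∀ {k} → ((Fin k → Bool) → Set) → Set
Invariant Q = ∀ {X Y} → X ≗ Y → Q X → Q Y

anySet? : ∀ {k} (Q : (Fin k → Bool) → Set) → Invariant Q → (∀ X → Dec (Q X)) → Dec (∃ Q)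
anySet? Q invariant Q? =
  map′ (λ (p , q) → lookup p , q)
       (λ (X , q) → tabulate X , invariant (λ i → sym (lookup∘tabulate X i)) q)
       (anySubset? (λ p → Q? (lookup p)))

allSets? : ∀ {k} (Q : (Fin k → Bool) → Set) → Invariant Q → (∀ X → Dec (Q X)) →
           Dec (∀ X → Q X)
allSets? Q invariant Q?
  with anySet? (λ X → ¬ Q X) (λ X≗Y ¬q q → ¬q (invariant (λ i → sym (X≗Y i)) q))
               (λ X → ¬? (Q? X))
... | yes (X , ¬q) = no λ all → ¬q (all X)
... | no none      = yes λ X → decidable-stable (Q? X) (λ ¬q → none (X , ¬q))

minimal : ∀ {n} {_≺_ : Fin n → Fin n → Set} → WellFounded _≺_ → (∀ l j → Dec (l ≺ j)) →
          {Q : Fin n → Set} → (∀ j → Dec (Q j)) →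
          ∀ {j} → Q j → ∃ λ k → Q k × (∀ l → l ≺ k → ¬ Q l)
minimal {_≺_ = _≺_} wf _≺?_ {Q} Q? {j} Qj = go j (wf j) Qj
  where
  go : ∀ j → Acc _≺_ j → Q j → ∃ λ k → Q k × (∀ l → l ≺ k → ¬ Q l)
  go j (acc rs) Qj with FP.any? (λ l → (l ≺? j) ×-dec Q? l)
  ... | yes (l , l≺j , Ql) = go l (rs l≺j) Ql
  ... | no none            = j , Qj , λ l l≺j Ql → none (l , l≺j , Ql)

module Semantics {s n : ℕ} (w : DataWord s n) where

  Val : ℕ → Set
  Val m = Vector (Fin n → Bool) m

  infix 4 _≈_ _⊑_
  _≈_ : Fin n → Fin n → Set
  _≈_ = _∼_ w

  _≈?_ : ∀ x y → Dec (x ≈ y)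
  x ≈? y = dat w x ℕ.≟ dat w y

  _⊑_ : ∀ {m} → Val m → Val m → Set
  ρ ⊑ ρ' = ∀ x j → T (ρ x j) → T (ρ' x j)

  ⊑-refl : ∀ {m} {ρ : Val m} → ρ ⊑ ρ
  ⊑-refl x j t = t

  ⊑-∷ : ∀ {m} {X Y : Fin n → Bool} {ρ ρ' : Val m} →
        (∀ j → T (X j) → T (Y j)) → ρ ⊑ ρ' → (X ∷ ρ) ⊑ (Y ∷ ρ')
  ⊑-∷ X⊆Y ρ⊑ρ' zero    = X⊆Y
  ⊑-∷ X⊆Y ρ⊑ρ' (suc x) = ρ⊑ρ' x

  -- All variables occur positively, so satisfaction is monotone in the valuation.
  mono : ∀ {m} {ρ ρ' : Val m} → ρ ⊑ ρ' → ∀ φ i → Sat w ρ φ i → Sat w ρ' φ i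
  mono le (var x)   i t             = le x i t
  mono le (pos A)   i t             = t
  mono le (neg A)   i t             = t
  mono le (mod M φ) i (j , r , t)   = j , r , mono le φ j t
  mono le (φ ∨ᶠ ψ)  i t             = Sum.map (mono le φ i) (mono le ψ i) t
  mono le (φ ∧ᶠ ψ)  i t             = Product.map (mono le φ i) (mono le ψ i) t
  mono le (μ φ)     i h X closed    = h X λ j t → closed j (mono (⊑-∷ (λ _ u → u) le) φ j t)
  mono le (ν φ)     i (X , inv , t) = X , (λ j u → mono (⊑-∷ (λ _ v → v) le) φ j (inv j u)) , t

  resp≗ : ∀ {m} {X Y : Fin n → Bool} {ρ : Val m} → X ≗ Y → ∀ φ j →
          Sat w (X ∷ ρ) φ j → Sat w (Y ∷ ρ) φ j
  resp≗ X≗Y = mono (⊑-∷ (λ k → subst T (X≗Y k)) ⊑-refl)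

  agree-∷ : ∀ {m k} {r : Fin m → Fin k} {ρ : Val m} {ρ' : Val k} (X : Fin n → Bool) →
            (∀ x → ρ' (r x) ≗ ρ x) → ∀ x → (X ∷ ρ') (lift 1 r x) ≗ (X ∷ ρ) x
  agree-∷ X e zero    j = refl
  agree-∷ X e (suc x) j = e x j

  ren⇔ : ∀ {m k} (r : Fin m → Fin k) {ρ : Val m} {ρ' : Val k} → (∀ x → ρ' (r x) ≗ ρ x) →
         ∀ φ i → Sat w ρ' (ren r φ) i ⇔ Sat w ρ φ i
  ren⇔ r e (var x)   i = mk⇔ (subst T (e x i)) (subst T (sym (e x i)))
  ren⇔ r e (pos A)   i = mk⇔ id id
  ren⇔ r e (neg A)   i = mk⇔ id id
  ren⇔ r e (mod M φ) i = mk⇔ (λ (j , m , t) → j , m , to (ren⇔ r e φ j) t)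
                             (λ (j , m , t) → j , m , from (ren⇔ r e φ j) t)
  ren⇔ r e (φ ∨ᶠ ψ)  i = mk⇔ (Sum.map (to (ren⇔ r e φ i)) (to (ren⇔ r e ψ i)))
                             (Sum.map (from (ren⇔ r e φ i)) (from (ren⇔ r e ψ i)))
  ren⇔ r e (φ ∧ᶠ ψ)  i = mk⇔ (Product.map (to (ren⇔ r e φ i)) (to (ren⇔ r e ψ i)))
                             (Product.map (from (ren⇔ r e φ i)) (from (ren⇔ r e ψ i)))
  ren⇔ r e (μ φ)     i =
    mk⇔ (λ h X closed → h X λ j t → closed j (to (ren⇔ (lift 1 r) (agree-∷ X e) φ j) t))
        (λ h X closed → h X λ j t → closed j (from (ren⇔ (lift 1 r) (agree-∷ X e) φ j) t))
  ren⇔ r e (ν φ)     i =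
    mk⇔ (λ (X , inv , t) → X , (λ j u → to (ren⇔ (lift 1 r) (agree-∷ X e) φ j) (inv j u)) , t)
        (λ (X , inv , t) → X , (λ j u → from (ren⇔ (lift 1 r) (agree-∷ X e) φ j) (inv j u)) , t)

  wk⇔ : ∀ {m} (X : Fin n → Bool) (ρ : Val m) θ j → Sat w (X ∷ ρ) (wk θ) j ⇔ Sat w ρ θ j
  wk⇔ X ρ θ = ren⇔ suc (λ x j → refl) θ

  -- Satisfaction is decidable: the fixpoint quantifiers range over finitely many sets.
  classSucc? : ∀ i j → Dec (ClassSucc w i j)
  classSucc? i j = (i FP.<? j) ×-dec ((j ≈? i) ×-dec
                   FP.all? (λ l → (i FP.<? l) →-dec ((l FP.<? j) →-dec ¬? (l ≈? i))))

  classPred? : ∀ i j → Dec (ClassPred w i j)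
  classPred? i j = (j FP.<? i) ×-dec ((j ≈? i) ×-dec
                   FP.all? (λ l → (j FP.<? l) →-dec ((l FP.<? i) →-dec ¬? (l ≈? i))))

  modRel? : ∀ M i j → Dec (ModRel w M i j)
  modRel? Xᵍ i j = toℕ j ℕ.≟ suc (toℕ i)
  modRel? Xᶜ     = classSucc?
  modRel? Yᵍ i j = toℕ i ℕ.≟ suc (toℕ j)
  modRel? Yᶜ     = classPred?

  atom? : ∀ A i → Dec (AtomHolds w A i)
  atom? (letter c) i = lab w i FP.≟ c
  atom? S          i = FP.any? λ j → modRel? Xᵍ i j ×-dec modRel? Xᶜ i j
  atom? P          i = FP.any? λ j → modRel? Yᵍ i j ×-dec modRel? Yᶜ i j
  atom? firstᵍ     i = toℕ i ℕ.≟ 0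
  atom? lastᵍ      i = suc (toℕ i) ℕ.≟ n
  atom? firstᶜ     i = ¬? (FP.any? (modRel? Yᶜ i))
  atom? lastᶜ      i = ¬? (FP.any? (modRel? Xᶜ i))

  Sat? : ∀ {m} (ρ : Val m) φ i → Dec (Sat w ρ φ i)
  Sat? ρ (var x)   i = T? (ρ x i)
  Sat? ρ (pos A)   i = atom? A i
  Sat? ρ (neg A)   i = ¬? (atom? A i)
  Sat? ρ (mod M φ) i = FP.any? λ j → modRel? M i j ×-dec Sat? ρ φ j
  Sat? ρ (φ ∨ᶠ ψ)  i = Sat? ρ φ i ⊎-dec Sat? ρ ψ i
  Sat? ρ (φ ∧ᶠ ψ)  i = Sat? ρ φ i ×-dec Sat? ρ ψ i
  Sat? ρ (μ φ)     i =
    allSets? _ (λ X≗Y h closed → subst T (X≗Y i) (h λ j t →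
                 subst T (sym (X≗Y j)) (closed j (resp≗ X≗Y φ j t))))
             (λ X → FP.all? (λ j → Sat? (X ∷ ρ) φ j →-dec T? (X j)) →-dec T? (X i))
  Sat? ρ (ν φ)     i =
    anySet? _ (λ X≗Y (inv , t) → (λ j u → resp≗ X≗Y φ j (inv j (subst T (sym (X≗Y j)) u))) ,
                                 subst T (X≗Y i) t)
            (λ X → FP.all? (λ j → T? (X j) →-dec Sat? (X ∷ ρ) φ j) ×-dec T? (X i))

  μ-elim : ∀ {m} (ρ : Val m) φ (Goal : Fin n → Set) (Goal? : ∀ i → Dec (Goal i)) →
           (∀ X → (∀ j → T (X j) → Goal j) → ∀ i → Sat w (X ∷ ρ) φ i → Goal i) →
           ∀ i → Sat w ρ (μ φ) i → Goal i
  μ-elim ρ φ Goal Goal? closed i h =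
    toWitness {a? = Goal? i}
      (h ⌊Goal⌋ λ j t → fromWitness (closed ⌊Goal⌋ (λ k → toWitness {a? = Goal? k}) j t))
    where
    ⌊Goal⌋ : Fin n → Bool
    ⌊Goal⌋ j = isYes (Goal? j)

  μ-intro : ∀ {m} (ρ : Val m) φ {_≺_ : Fin n → Fin n → Set} → WellFounded _≺_ →
            (Goal : Fin n → Set) →
            (∀ X i → Goal i → (∀ k → k ≺ i → Goal k → T (X k)) → Sat w (X ∷ ρ) φ i) →
            ∀ i → Goal i → Sat w ρ (μ φ) i
  μ-intro ρ φ {_≺_} wf Goal step i Gi X closed = go i (wf i) Gi
    where
    go : ∀ i → Acc _≺_ i → Goal i → T (X i)
    go i (acc rs) Gi = closed i (step X i Gi λ k k≺i → go k (rs k≺i))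

  -- A stepping of M describes the transitive closure Far of the M-steps in a
  -- form suited for induction along the steps.
  record Stepping (M : Mod) : Set₁ where
    field
      Far      : Fin n → Fin n → Set
      far?     : ∀ i j → Dec (Far i j)
      step⇒far : ∀ {i k} → ModRel w M i k → Far i k
      step-far : ∀ {i k j} → ModRel w M i k → Far k j → Far i j
      far⇒step : ∀ {i j} → Far i j → ∃ (ModRel w M i)
      split    : ∀ {i k j} → ModRel w M i k → Far i j → k ≡ j ⊎ Far k j
      wf       : WellFounded (λ k i → ModRel w M i k)
      edge⇔    : ∀ i → AtomHolds w (edge M) i ⇔ (¬ ∃ (ModRel w M i))

  module Along {M : Mod} (St : Stepping M) where
    open Stepping St

    ◇⇔ : ∀ {m} (ρ : Val m) θ i → Sat w ρ (◇ M θ) i ⇔ (∃ λ j → Far i j × Sat w ρ θ j)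
    ◇⇔ {m} ρ θ i = mk⇔ (μ-elim ρ body Target target? closed i) (μ-intro ρ body wf Target step i)
      where
      body : Form s (suc m)
      body = mod M (wk θ ∨ᶠ var zero)
      Target : Fin n → Set
      Target i = ∃ λ j → Far i j × Sat w ρ θ j
      target? : ∀ i → Dec (Target i)
      target? i = FP.any? λ j → far? i j ×-dec Sat? ρ θ j
      closed : ∀ X → (∀ j → T (X j) → Target j) →
               ∀ i → Sat w (X ∷ ρ) body i → Target i
      closed X X⊆T i (k , i→k , inj₁ θk) = k , step⇒far i→k , to (wk⇔ X ρ θ k) θk
      closed X X⊆T i (k , i→k , inj₂ Xk) with X⊆T k Xk
      ... | j , far , θj = j , step-far i→k far , θj
      step : ∀ X i → Target i → (∀ k → ModRel w M i k → Target k → T (X k)) →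
             Sat w (X ∷ ρ) body i
      step X i (j , far , θj) ih with far⇒step far
      ... | k , i→k with split i→k far
      ...   | inj₁ refl = k , i→k , inj₁ (from (wk⇔ X ρ θ k) θj)
      ...   | inj₂ far′ = k , i→k , inj₂ (ih k i→k (j , far′ , θj))

    □⇔ : ∀ {m} (ρ : Val m) θ i → Sat w ρ (□ M θ) i ⇔ (∀ j → Far i j → Sat w ρ θ j)
    □⇔ {m} ρ θ i = mk⇔ (μ-elim ρ body Target target? closed i) (μ-intro ρ body wf Target step i)
      where
      body : Form s (suc m)
      body = pos (edge M) ∨ᶠ mod M (wk θ ∧ᶠ var zero)
      Target : Fin n → Set
      Target i = ∀ j → Far i j → Sat w ρ θ j
      target? : ∀ i → Dec (Target i)
      target? i = FP.all? λ j → far? i j →-dec Sat? ρ θ j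
      closed : ∀ X → (∀ j → T (X j) → Target j) →
               ∀ i → Sat w (X ∷ ρ) body i → Target i
      closed X X⊆T i (inj₁ atEdge) j far = ⊥-elim (to (edge⇔ i) atEdge (far⇒step far))
      closed X X⊆T i (inj₂ (k , i→k , θk , Xk)) j far with split i→k far
      ... | inj₁ refl = to (wk⇔ X ρ θ k) θk
      ... | inj₂ far′ = X⊆T k Xk j far′
      step : ∀ X i → Target i → (∀ k → ModRel w M i k → Target k → T (X k)) →
             Sat w (X ∷ ρ) body i
      step X i all ih with FP.any? (modRel? M i)
      ... | no none        = inj₁ (from (edge⇔ i) none)
      ... | yes (k , i→k) = inj₂ (k , i→k , from (wk⇔ X ρ θ k) (all k (step⇒far i→k)) ,
                                  ih k i→k λ j far → all j (step-far i→k far))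

  successor : (i : Fin n) → suc (toℕ i) ℕ.< n → ∃ λ (k : Fin n) → toℕ k ≡ suc (toℕ i)
  successor i lt = fromℕ< lt , FP.toℕ-fromℕ< lt

  predecessor : (i : Fin n) → toℕ i ≢ 0 → ∃ λ (k : Fin n) → toℕ i ≡ suc (toℕ k)
  predecessor zero    i≢0 = ⊥-elim (i≢0 refl)
  predecessor (suc i) _   = inject₁ i , cong suc (sym (FP.toℕ-inject₁ i))

  adjacent⇒< : ∀ {i k : Fin n} → toℕ k ≡ suc (toℕ i) → i <ᶠ k
  adjacent⇒< e = ℕP.≤-reflexive (sym e)

  nothing-between : ∀ {i j k : Fin n} → toℕ k ≡ suc (toℕ i) → i <ᶠ j → ¬ (j <ᶠ k)
  nothing-between e i<j j<k = ℕP.<⇒≱ i<j (ℕP.≤-pred (subst (ℕ._<_ _) e j<k))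

  next : Stepping Xᵍ
  next = record
    { Far      = _<ᶠ_
    ; far?     = FP._<?_
    ; step⇒far = adjacent⇒<
    ; step-far = λ i→k k<j → FP.<-trans (adjacent⇒< i→k) k<j
    ; far⇒step = λ {i} {j} i<j → successor i (ℕP.≤-<-trans i<j (FP.toℕ<n j))
    ; split    = split
    ; wf       = Subrelation.wellFounded adjacent⇒< >-wellFounded
    ; edge⇔    = λ i → mk⇔ (λ last (k , e) → ℕP.<-irrefl (trans e last) (FP.toℕ<n k))
                         (λ none → decidable-stable (suc (toℕ i) ℕ.≟ n)
                            λ ¬last → none (successor i (ℕP.≤∧≢⇒< (FP.toℕ<n i) ¬last)))
    }
    where
    split : ∀ {i k j : Fin n} → toℕ k ≡ suc (toℕ i) → i <ᶠ j → k ≡ j ⊎ k <ᶠ j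
    split {k = k} {j} i→k i<j with FP.<-cmp k j
    ... | tri< k<j _ _ = inj₂ k<j
    ... | tri≈ _ k≡j _ = inj₁ k≡j
    ... | tri> _ _ j<k = ⊥-elim (nothing-between i→k i<j j<k)

  prev : Stepping Yᵍ
  prev = record
    { Far      = λ i j → j <ᶠ i
    ; far?     = λ i j → j FP.<? i
    ; step⇒far = adjacent⇒<
    ; step-far = λ i→k j<k → FP.<-trans j<k (adjacent⇒< i→k)
    ; far⇒step = λ {i} {j} j<i → predecessor i λ i≡0 → ℕP.n≮0 (subst (ℕ._<_ _) i≡0 j<i)
    ; split    = split
    ; wf       = Subrelation.wellFounded adjacent⇒< <-wellFounded
    ; edge⇔    = λ i → mk⇔ (λ first (k , e) → ℕP.0≢1+n (trans (sym first) e))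
                         (λ none → decidable-stable (toℕ i ℕ.≟ 0)
                            λ i≢0 → none (predecessor i i≢0))
    }
    where
    split : ∀ {i k j : Fin n} → toℕ i ≡ suc (toℕ k) → j <ᶠ i → k ≡ j ⊎ j <ᶠ k
    split {k = k} {j} i→k j<i with FP.<-cmp k j
    ... | tri< k<j _ _ = ⊥-elim (nothing-between i→k k<j j<i)
    ... | tri≈ _ k≡j _ = inj₁ k≡j
    ... | tri> _ _ j<k = inj₂ j<k

  classSucc-exists : ∀ {i j : Fin n} → i <ᶠ j → j ≈ i → ∃ (ClassSucc w i)
  classSucc-exists {i} i<j j≈i
    with minimal <-wellFounded FP._<?_ (λ l → (i FP.<? l) ×-dec (l ≈? i)) (i<j , j≈i)
  ... | k , (i<k , k≈i) , least = k , i<k , k≈i , λ l i<l l<k l≈i → least l l<k (i<l , l≈i)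

  classPred-exists : ∀ {i j : Fin n} → j <ᶠ i → j ≈ i → ∃ (ClassPred w i)
  classPred-exists {i} j<i j≈i
    with minimal >-wellFounded (λ l k → k FP.<? l) (λ l → (l FP.<? i) ×-dec (l ≈? i)) (j<i , j≈i)
  ... | k , (k<i , k≈i) , greatest = k , k<i , k≈i , λ l k<l l<i l≈i → greatest l k<l (l<i , l≈i)

  classNext : Stepping Xᶜ
  classNext = record
    { Far      = λ i j → i <ᶠ j × j ≈ i
    ; far?     = λ i j → (i FP.<? j) ×-dec (j ≈? i)
    ; step⇒far = λ (i<k , k≈i , _) → i<k , k≈i
    ; step-far = λ (i<k , k≈i , _) (k<j , j≈k) → FP.<-trans i<k k<j , trans j≈k k≈i
    ; far⇒step = λ (i<j , j≈i) → classSucc-exists i<j j≈i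
    ; split    = split
    ; wf       = Subrelation.wellFounded proj₁ >-wellFounded
    ; edge⇔    = λ i → mk⇔ id id
    }
    where
    split : ∀ {i k j} → ClassSucc w i k → i <ᶠ j × j ≈ i → k ≡ j ⊎ (k <ᶠ j × j ≈ k)
    split {k = k} {j} (i<k , k≈i , nearest) (i<j , j≈i) with FP.<-cmp k j
    ... | tri< k<j _ _ = inj₂ (k<j , trans j≈i (sym k≈i))
    ... | tri≈ _ k≡j _ = inj₁ k≡j
    ... | tri> _ _ j<k = ⊥-elim (nearest j i<j j<k j≈i)

  classPrev : Stepping Yᶜ
  classPrev = record
    { Far      = λ i j → j <ᶠ i × j ≈ i
    ; far?     = λ i j → (j FP.<? i) ×-dec (j ≈? i)
    ; step⇒far = λ (k<i , k≈i , _) → k<i , k≈i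
    ; step-far = λ (k<i , k≈i , _) (j<k , j≈k) → FP.<-trans j<k k<i , trans j≈k k≈i
    ; far⇒step = λ (j<i , j≈i) → classPred-exists j<i j≈i
    ; split    = split
    ; wf       = Subrelation.wellFounded proj₁ <-wellFounded
    ; edge⇔    = λ i → mk⇔ id id
    }
    where
    split : ∀ {i k j} → ClassPred w i k → j <ᶠ i × j ≈ i → k ≡ j ⊎ (j <ᶠ k × j ≈ k)
    split {k = k} {j} (k<i , k≈i , nearest) (j<i , j≈i) with FP.<-cmp k j
    ... | tri< k<j _ _ = ⊥-elim (nearest j k<j j<i j≈i)
    ... | tri≈ _ k≡j _ = inj₁ k≡j
    ... | tri> _ _ j<k = inj₂ (j<k , trans j≈i (sym k≈i))

  open Along using (◇⇔; □⇔)

  elsewhere⇔ : ∀ {m} (ρ : Val m) θ i →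
               Sat w ρ (elsewhere θ) i ⇔ (∃ λ j → j ≢ i × j ≈ i × Sat w ρ θ j)
  elsewhere⇔ ρ θ i = mk⇔ sound complete
    where
    sound : Sat w ρ (elsewhere θ) i → ∃ λ j → j ≢ i × j ≈ i × Sat w ρ θ j
    sound (inj₁ later) with to (◇⇔ classNext ρ θ i) later
    ... | j , (i<j , j≈i) , θj = j , (λ j≡i → FP.<⇒≢ i<j (sym j≡i)) , j≈i , θj
    sound (inj₂ earlier) with to (◇⇔ classPrev ρ θ i) earlier
    ... | j , (j<i , j≈i) , θj = j , FP.<⇒≢ j<i , j≈i , θj
    complete : (∃ λ j → j ≢ i × j ≈ i × Sat w ρ θ j) → Sat w ρ (elsewhere θ) i
    complete (j , j≢i , j≈i , θj) with FP.<-cmp i j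
    ... | tri< i<j _ _ = inj₁ (from (◇⇔ classNext ρ θ i) (j , (i<j , j≈i) , θj))
    ... | tri≈ _ i≡j _ = ⊥-elim (j≢i (sym i≡j))
    ... | tri> _ _ j<i = inj₂ (from (◇⇔ classPrev ρ θ i) (j , (j<i , j≈i) , θj))

Monotone : ∀ {n} → (Fin n → Fin n → Set) → Set
Monotone Rel = ∀ x x′ y y′ → Rel x y → Rel x′ y′ → x <ᶠ x′ → y <ᶠ y′

Functional : ∀ {n} → (Fin n → Fin n → Set) → Set
Functional Rel = ∀ {x y y′} → Rel x y → Rel x y′ → y ≡ y′

monotone-converse : ∀ {n} {Rel : Fin n → Fin n → Set} →
                    Functional Rel → Monotone Rel → Monotone (flip Rel)
monotone-converse functional monotone y y′ x x′ xRy x′Ry′ y<y′ with FP.<-cmp x x′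
... | tri< x<x′ _ _    = x<x′
... | tri≈ _ refl _    = ⊥-elim (FP.<⇒≢ y<y′ (functional xRy x′Ry′))
... | tri> _ _ x′<x    = ⊥-elim (FP.<-asym y<y′ (monotone x′ x y′ y x′Ry′ xRy x′<x))

module Formula {s : ℕ} (a b : Fin s) where

  matched : Fin s → Fin s → Form s 0
  matched c d = neg (letter c) ∨ᶠ (elsewhere (pos (letter d)) ∧ᶠ □ Xᶜ (neg (letter c)))

  -- (X: the positions in order) a b-position has an a-partner in X
  partnerInX : Form s 1
  partnerInX = neg (letter b) ∨ᶠ elsewhere (pos (letter a) ∧ᶠ var zero)

  guarded : Form s 1
  guarded = neg (letter a) ∨ᶠ elsewhere (pos (letter b) ∧ᶠ □ Yᵍ partnerInX)

  -- every earlier position is in X and this one is guarded; the least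
  -- fixpoint `ordered` holds exactly at the positions in order up to themselves
  orderedBody : Form s 1
  orderedBody = □ Yᵍ (var zero) ∧ᶠ guarded

  ordered : Form s 0
  ordered = μ orderedBody

  local : Form s 0
  local = matched a b ∧ᶠ (matched b a ∧ᶠ ordered)

  Φ : Sentence s
  Φ = local ∧ᶠ □ Xᵍ local

module Correctness {s n : ℕ} (a b : Fin s) (a≢b : a ≢ b) (w : DataWord s n) where
  open Semantics w
  open Along using (◇⇔; □⇔)
  open Formula a b

  Match : Fin s → Fin s → Fin n → Fin n → Set
  Match c d x y = lab w x ≡ c × lab w y ≡ d × x ≈ y

  converse : ∀ {c d x y} → Match c d x y → Match d c y x
  converse (cx , dy , x≈y) = dy , cx , sym x≈y

  match? : ∀ x y → Dec (Match a b x y)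
  match? x y = (lab w x FP.≟ a) ×-dec ((lab w y FP.≟ b) ×-dec (x ≈? y))

  distinct : ∀ {c d x y} → c ≢ d → lab w x ≡ c → lab w y ≡ d → y ≢ x
  distinct c≢d cx dy refl = c≢d (trans (sym cx) dy)

  MatchedAt : Fin s → Fin s → Fin n → Set
  MatchedAt c d x = lab w x ≡ c →
    (∃ λ y → y ≢ x × y ≈ x × lab w y ≡ d) × (∀ k → x <ᶠ k → k ≈ x → lab w k ≢ c)

  matched⇔ : ∀ c d x → Sat w [] (matched c d) x ⇔ MatchedAt c d x
  matched⇔ c d x = mk⇔ sound complete
    where
    sound : Sat w [] (matched c d) x → MatchedAt c d x
    sound (inj₁ ¬cx)            cx = ⊥-elim (¬cx cx)
    sound (inj₂ (other , later)) _ =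
      to (elsewhere⇔ [] (pos (letter d)) x) other ,
      λ k x<k k≈x → to (□⇔ classNext [] (neg (letter c)) x) later k (x<k , k≈x)
    complete : MatchedAt c d x → Sat w [] (matched c d) x
    complete h with lab w x FP.≟ c
    ... | no ¬cx = inj₁ ¬cx
    ... | yes cx = inj₂ (from (elsewhere⇔ [] (pos (letter d)) x) (proj₁ (h cx)) ,
                         from (□⇔ classNext [] (neg (letter c)) x)
                           λ k (x<k , k≈x) → proj₂ (h cx) k x<k k≈x)

  Partnered : Fin s → Fin s → Set
  Partnered c d = ∀ x → lab w x ≡ c →
    Σ (Fin n) λ y → Match c d x y × (∀ y′ → Match c d x y′ → y′ ≡ y)

  functional : ∀ {c d} → Partnered c d → Functional (Match c d)
  functional partnered {x} xy xy′ with partnered x (proj₁ xy)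
  ... | _ , _ , unique = trans (unique _ xy) (sym (unique _ xy′))

  OnePerClass : Fin s → Set
  OnePerClass c = ∀ u v → lab w u ≡ c → lab w v ≡ c → u ≈ v → u ≡ v

  onePerClass : ∀ {c d} → (∀ x → MatchedAt c d x) → OnePerClass c
  onePerClass matched u v cu cv u≈v with FP.<-cmp u v
  ... | tri< u<v _ _ = ⊥-elim (proj₂ (matched u cu) v u<v (sym u≈v) cv)
  ... | tri≈ _ u≡v _ = u≡v
  ... | tri> _ _ v<u = ⊥-elim (proj₂ (matched v cv) u v<u u≈v cu)

  matched⇒partnered : ∀ {c d} → (∀ x → MatchedAt c d x) → (∀ y → MatchedAt d c y) →
                      Partnered c d
  matched⇒partnered mc md x cx with proj₁ (mc x cx)
  ... | y , _ , y≈x , dy =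
    y , (cx , dy , sym y≈x) ,
    λ y′ (_ , dy′ , x≈y′) → onePerClass md y′ y dy′ dy (trans (sym x≈y′) (sym y≈x))

  partnered⇒matched : ∀ {c d} → c ≢ d → Partnered c d → Partnered d c →
                      ∀ x → MatchedAt c d x
  partnered⇒matched {c} c≢d pc pd x cx with pc x cx
  ... | y , (_ , dy , x≈y) , _ = (y , distinct c≢d cx dy , sym x≈y , dy) , later
    where
    later : ∀ k → x <ᶠ k → k ≈ x → lab w k ≢ c
    later k x<k k≈x ck with pd y dy
    ... | _ , _ , unique =
      FP.<⇒≢ x<k (trans (unique x (converse (cx , dy , x≈y)))
                        (sym (unique k (converse (ck , dy , trans k≈x x≈y)))))

  Copartnered : Fin s → Fin s → Set
  Copartnered c d = ∀ y → lab w y ≡ d →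
    Σ (Fin n) λ x → Match c d x y × (∀ x′ → Match c d x′ y → x′ ≡ x)

  copartnered⇔ : ∀ {c d} → Copartnered c d ⇔ Partnered d c
  copartnered⇔ {c} {d} = mk⇔ forward backward
    where
    forward : Copartnered c d → Partnered d c
    forward cp y dy with cp y dy
    ... | x , xy , unique = x , converse xy , λ x′ yx′ → unique x′ (converse yx′)
    backward : Partnered d c → Copartnered c d
    backward pd y dy with pd y dy
    ... | x , yx , unique = x , converse yx , λ x′ x′y → unique x′ (converse x′y)

  InOrder : Fin n → Set
  InOrder x = ∀ x′ y y′ → Match a b x y → Match a b x′ y′ → y′ <ᶠ y → x′ <ᶠ x

  InOrderUpTo : Fin n → Set
  InOrderUpTo x = ∀ z → z ≤ᶠ x → InOrder z

  inOrderUpTo? : ∀ x → Dec (InOrderUpTo x)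
  inOrderUpTo? x = FP.all? λ z → (z FP.≤? x) →-dec
    FP.all? λ x′ → FP.all? λ y → FP.all? λ y′ →
    match? z y →-dec (match? x′ y′ →-dec ((y′ FP.<? y) →-dec (x′ FP.<? z)))

  guarded-sound : OnePerClass a → OnePerClass b → ∀ X {x x′ y y′} → Sat w (X ∷ []) guarded x →
                  Match a b x y → Match a b x′ y′ → y′ <ᶠ y → T (X x′)
  guarded-sound sa sb X (inj₁ ¬ax) (ax , _) _ _ = ⊥-elim (¬ax ax)
  guarded-sound sa sb X {x} {x′} {y} {y′} (inj₂ other)
                (ax , by , x≈y) (ax′ , by′ , x′≈y′) y′<y
    with to (elsewhere⇔ (X ∷ []) (pos (letter b) ∧ᶠ □ Yᵍ partnerInX) x) other
  ... | y₀ , _ , y₀≈x , by₀ , before with sb y₀ y by₀ by (trans y₀≈x x≈y)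
  ... | refl with to (□⇔ prev (X ∷ []) partnerInX y₀) before y′ y′<y
  ...   | inj₁ ¬by′ = ⊥-elim (¬by′ by′)
  ...   | inj₂ other′ with to (elsewhere⇔ (X ∷ []) (pos (letter a) ∧ᶠ var zero) y′) other′
  ...     | x₀ , _ , x₀≈y′ , ax₀ , Xx₀ =
    subst (λ p → T (X p)) (sa x₀ x′ ax₀ ax′ (trans x₀≈y′ (sym x′≈y′))) Xx₀

  guarded-complete : Partnered a b → Partnered b a → ∀ X x →
                     (∀ x′ y y′ → Match a b x y → Match a b x′ y′ → y′ <ᶠ y → T (X x′)) →
                     Sat w (X ∷ []) guarded x
  guarded-complete pa pb X x inX with lab w x FP.≟ a
  ... | no ¬ax = inj₁ ¬ax
  ... | yes ax with pa x ax
  ...   | y , xy@(_ , by , x≈y) , _ =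
    inj₂ (from (elsewhere⇔ (X ∷ []) (pos (letter b) ∧ᶠ □ Yᵍ partnerInX) x)
           (y , distinct a≢b ax by , sym x≈y , by ,
            from (□⇔ prev (X ∷ []) partnerInX y) partnerBefore))
    where
    partnerBefore : ∀ y′ → y′ <ᶠ y → Sat w (X ∷ []) partnerInX y′
    partnerBefore y′ y′<y with lab w y′ FP.≟ b
    ... | no ¬by′ = inj₁ ¬by′
    ... | yes by′ with pb y′ by′
    ...   | x′ , (_ , ax′ , y′≈x′) , _ =
      inj₂ (from (elsewhere⇔ (X ∷ []) (pos (letter a) ∧ᶠ var zero) y′)
             (x′ , distinct (λ b≡a → a≢b (sym b≡a)) by′ ax′ , sym y′≈x′ , ax′ ,
              inX x′ y y′ xy (ax′ , by′ , sym y′≈x′) y′<y))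

  ordered-sound : OnePerClass a → OnePerClass b → ∀ x → Sat w [] ordered x → InOrderUpTo x
  ordered-sound sa sb = μ-elim [] orderedBody InOrderUpTo inOrderUpTo? closed
    where
    closed : ∀ X → (∀ j → T (X j) → InOrderUpTo j) →
             ∀ x → Sat w (X ∷ []) orderedBody x → InOrderUpTo x
    closed X X⊆ x (before , g) = upTo
      where
      -- a later a-partner x′ would be in X, hence have x in order: contradiction
      inOrder : InOrder x
      inOrder x′ y y′ xy@(_ , by , x≈y) x′y′@(_ , by′ , x′≈y′) y′<y with FP.<-cmp x′ x
      ... | tri< x′<x _ _ = x′<x
      ... | tri≈ _ refl _ = ⊥-elim (FP.<⇒≢ y′<y (sb y′ y by′ by (trans (sym x′≈y′) x≈y)))
      ... | tri> _ _ x<x′ = ⊥-elim (FP.<-asym x<x′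
              (X⊆ x′ (guarded-sound sa sb X g xy x′y′ y′<y) x (ℕP.<⇒≤ x<x′) x′ y y′ xy x′y′ y′<y))
      upTo : InOrderUpTo x
      upTo z z≤x with z FP.≟ x
      ... | yes refl = inOrder
      ... | no z≢x   =
        X⊆ z (to (□⇔ prev (X ∷ []) (var zero) x) before z (FP.≤∧≢⇒< z≤x z≢x)) z FP.≤-refl

  ordered-complete : Partnered a b → Partnered b a → (∀ x → InOrder x) →
                     ∀ x → Sat w [] ordered x
  ordered-complete pa pb inOrder x = μ-intro [] orderedBody <-wellFounded (λ _ → ⊤) step x tt
    where
    step : ∀ X x → ⊤ → (∀ k → k <ᶠ x → ⊤ → T (X k)) → Sat w (X ∷ []) orderedBody x
    step X x _ ih =
      from (□⇔ prev (X ∷ []) (var zero) x) (λ z z<x → ih z z<x tt) ,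
      guarded-complete pa pb X x λ x′ y y′ xy x′y′ y′<y → ih x′ (inOrder x x′ y y′ xy x′y′ y′<y) tt

  local-everywhere⇔ : (∀ x → Sat w [] local x) ⇔ IncreasingBijection a b w
  local-everywhere⇔ = mk⇔ sound complete
    where
    sound : (∀ x → Sat w [] local x) → IncreasingBijection a b w
    sound all =
      pa , from copartnered⇔ pb ,
      monotone-converse (λ x′y x″y → functional pb (converse x′y) (converse x″y)) monotone⁻¹
      where
      mA : ∀ x → MatchedAt a b x
      mA x = to (matched⇔ a b x) (proj₁ (all x))
      mB : ∀ y → MatchedAt b a y
      mB y = to (matched⇔ b a y) (proj₁ (proj₂ (all y)))
      pa : Partnered a b
      pa = matched⇒partnered mA mB
      pb : Partnered b a
      pb = matched⇒partnered mB mA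
      monotone⁻¹ : Monotone (flip (Match a b))
      monotone⁻¹ y′ y x′ x x′y′ xy y′<y =
        ordered-sound (onePerClass mA) (onePerClass mB) x (proj₂ (proj₂ (all x)))
                      x FP.≤-refl x′ y y′ xy x′y′ y′<y
    complete : IncreasingBijection a b w → ∀ x → Sat w [] local x
    complete (pa , cb , monotone) x =
      from (matched⇔ a b x) (partnered⇒matched a≢b pa pb x) ,
      from (matched⇔ b a x) (partnered⇒matched (λ b≡a → a≢b (sym b≡a)) pb pa x) ,
      ordered-complete pa pb inOrder x
      where
      pb : Partnered b a
      pb = to copartnered⇔ cb
      inOrder : ∀ x → InOrder x
      inOrder x x′ y y′ xy x′y′ = monotone-converse (functional pa) monotone y′ y x′ x x′y′ xy

everywhere : ∀ {s m} (w : DataWord s (suc m)) (θ : Sentence s) →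
             (w ⊨ (θ ∧ᶠ □ Xᵍ θ)) ⇔ (∀ j → Sat w [] θ j)
everywhere w θ = mk⇔
  (λ (θ₀ , later) → λ { zero → θ₀ ; (suc j) → to (□⇔ next [] θ zero) later (suc j) z<s })
  (λ all → all zero , from (□⇔ next [] θ zero) λ j _ → all j)
  where
  open Semantics w
  open Along using (□⇔)

lemma2 : (s : ℕ) (a b : Fin s) → a ≢ b →
    Σ (Sentence s) λ φ → NuFree φ ×
      ((m : ℕ) (w : DataWord s (suc m)) → (w ⊨ φ) ⇔ IncreasingBijection a b w)
lemma2 s a b a≢b = Φ , toWitness {a? = nuFree? Φ} tt ,
  λ m w → ⇔-trans (everywhere w local) (Correctness.local-everywhere⇔ a b a≢b w)
  where open Formula a b
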